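{- If $m\equiv^e_k A_a(k,b)\cdot p+q$ and $1<k\le\lambda\le\omega$, then \[\langle k\to\lambda\rangle m=A_{\langle k\to\lambda\rangle a}(\lambda,\langle k\to\lambda\rangle b)\cdot p+\langle k\to\lambda\rangle q.\]
   Context: Ackermann function: for $k\ge 2$, $a,b\ge 0$: $A_a(k,-1):=1$, $A_0(k,b):=k^b$, $A_{a+1}(k,b):=A_a(k,\cdot)^k(A_{a+1}(k,b-1))$, with $f^j$ the $j$-fold iterate; write $A_xy=A_x(k,y)$. $k$-normal form: for $m>0$, $m\equiv_k A_ab+c$ means $m=A_ab+c$ and there exist $n\ge1$ and naturals $a_1..a_n$, $b_1..b_n$, $m_0..m_n$ with $m_0=0$; for $0\le i<n$: $A_{a_{i+1}}m_i\le m<A_{a_{i+1}+1}m_i$, $A_{a_{i+1}}b_{i+1}\le m<A_{a_{i+1}}(b_{i+1}+1)$, $m_{i+1}=A_{a_{i+1}}b_{i+1}$; $A_0m_n>m$; $a=a_n$, $b=b_n$ (unique for each $m>0$). Extended $k$-normal form: $m\equiv^e_k A_ab\cdot p+q$ means $m\equiv_k A_ab+c$ for some $c$, $m=A_ab\cdot p+q$, and $0\le q<A_ab$. Modified Veblen functions: $\varphi_0\beta=\omega^\beta$; for $\alpha>0$, $\varphi_\alpha\beta$ is the $\beta$-th common fixed point of all $\varphi_\xi$, $\xi<\alpha$. $\bar\phi_\alpha\beta=\varphi_\alpha(\beta+1)$ if $\beta=\beta_0+n$ for some $n<\omega$ and some $\beta_0$ with $\varphi_\alpha\beta_0=\beta_0$;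 otherwise $\bar\phi_\alpha\beta=\varphi_\alpha\beta$. Set $A_\alpha(\omega,\beta):=\bar\phi_\alpha\beta$. Base change: for $k\ge2$ and $\lambda\in\{2,3,\dots\}\cup\{\omega\}$: $\langle k\to\lambda\rangle0=0$ and, if $m\equiv_k A_ab+c$, $\langle k\to\lambda\rangle m=A_{\langle k\to\lambda\rangle a}(\lambda,\langle k\to\lambda\rangle b)+\langle k\to\lambda\rangle c$ (ordinal arithmetic when $\lambda=\omega$). -}

module Defs where

open import Data.Nat using (ℕ; zero; suc; _+_; _*_; _^_; _≤_; _<_)
open import Data.Bool using (Bool; true; false; _∧_; if_then_else_)
open import Data.Product using (Σ; _×_; ∃)
open import Data.Unit using (⊤)
open import Relation.Binary.PropositionalEquality using (_≡_)

-- Ackermann function  A_a(k,b)  (the value A_a(k,-1) = 1 is encoded by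
-- shifting the second argument by one: Ack′ k a (suc b) = A_a(k,b),
-- Ack′ k a 0 = A_a(k,-1) = 1).

mutual
  Ack′ : ℕ → ℕ → ℕ → ℕ
  Ack′ k a       zero    = 1
  Ack′ k zero    (suc b) = k ^ b
  Ack′ k (suc a) (suc b) = iterAck k a k (Ack′ k (suc a) b)

  iterAck : ℕ → ℕ → ℕ → ℕ → ℕ
  iterAck k a zero    x = x
  iterAck k a (suc n) x = Ack′ k a (suc (iterAck k a n x))

Ack : ℕ → ℕ → ℕ → ℕ
Ack k a b = Ack′ k a (suc b)

-- k-normal form, exactly as in the paper:
-- m ≡_k A_a b + c.  Sequences a_1..a_n, b_1..b_n, m_0..m_n are given as
-- functions ℕ → ℕ (only the indices used matter).

record KNF (k m a b c : ℕ) : Set where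
  field
    m-pos : 0 < m
    n     : ℕ
    as bs ms : ℕ → ℕ
    n-pos : 1 ≤ n
    m₀    : ms 0 ≡ 0
    steps : ∀ i → i < n →
              (Ack k (as (suc i)) (ms i) ≤ m × m < Ack k (suc (as (suc i))) (ms i))
            × (Ack k (as (suc i)) (bs (suc i)) ≤ m × m < Ack k (as (suc i)) (suc (bs (suc i))))
            × ms (suc i) ≡ Ack k (as (suc i)) (bs (suc i))
    final : m < Ack k 0 (ms n)
    a≡    : a ≡ as n
    b≡    : b ≡ bs n
    sum   : m ≡ Ack k a b + c

record ExtKNF (k m a b p q : ℕ) : Set where
  field
    c     : ℕ
    knf   : KNF k m a b c
    eqn   : m ≡ Ack k a b * p + q
    q<    : q < Ack k a b

-- Ordinals below Γ₀ in Veblen normal form.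
-- ph a b r  denotes  φ_a(b) + r  (φ = the (modified, i.e. standard
-- enumerating) binary Veblen function: φ_0 β = ω^β, φ_α β = β-th common
-- fixed point of all φ_ξ, ξ < α).  Terms produced by the operations below
-- are in normal form (summands non-increasing, in every φ_a(b) the argument
-- b is not a fixed point of φ_a), so equality of ordinals is ≡.

data OT : Set where
  𝟎  : OT
  ph : OT → OT → OT → OT

data Cmp : Set where
  lt eq gt : Cmp

mutual
  cmp : OT → OT → Cmp
  cmp 𝟎 𝟎 = eq
  cmp 𝟎 (ph _ _ _) = lt
  cmp (ph _ _ _) 𝟎 = gt
  cmp (ph a b r) (ph a′ b′ r′) with cmpPP a b a′ b′
  ... | lt = lt
  ... | gt = gt
  ... | eq = cmp r r′

  cmpPP : OT → OT → OT → OT → Cmp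
  cmpPP a b a′ b′ with cmp a a′
  ... | lt = cmpTP b a′ b′
  ... | eq = cmp b b′
  ... | gt = cmpPT a b b′

  cmpTP : OT → OT → OT → Cmp
  cmpTP 𝟎 a′ b′ = lt
  cmpTP (ph a b r) a′ b′ with cmpPP a b a′ b′
  ... | lt = lt
  ... | gt = gt
  ... | eq = isZero r
    where
    isZero : OT → Cmp
    isZero 𝟎 = eq
    isZero (ph _ _ _) = gt

  cmpPT : OT → OT → OT → Cmp
  cmpPT a b 𝟎 = gt
  cmpPT a b (ph a′ b′ r′) with cmpPP a b a′ b′
  ... | lt = lt
  ... | gt = gt
  ... | eq = isZero r′
    where
    isZero : OT → Cmp
    isZero 𝟎 = eq
    isZero (ph _ _ _) = lt

_>ᵒ_ : OT → OT → Bool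
x >ᵒ y with cmp x y
... | gt = true
... | _  = false

_+ᵒ_ : OT → OT → OT
𝟎 +ᵒ y = y
ph a b r +ᵒ 𝟎 = ph a b r
ph a b r +ᵒ ph a′ b′ r′ with cmpPP a b a′ b′
... | lt = ph a′ b′ r′
... | _  = ph a b (r +ᵒ ph a′ b′ r′)

𝟏 : OT
𝟏 = ph 𝟎 𝟎 𝟎

_·ᵒ_ : OT → ℕ → OT
x ·ᵒ zero  = 𝟎
x ·ᵒ suc p = (x ·ᵒ p) +ᵒ x

-- the Veblen function φ_a b (on normal forms): φ_a b = b exactly when
-- b = φ_c d with c > a; otherwise the normal form is φ_a b itself.
φ : OT → OT → OT
φ a 𝟎 = ph a 𝟎 𝟎
φ a (ph c d 𝟎) = if c >ᵒ a then ph c d 𝟎 else ph a (ph c d 𝟎) 𝟎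
φ a (ph c d (ph e f g)) = ph a (ph c d (ph e f g)) 𝟎

isFin : OT → Bool
isFin 𝟎 = true
isFin (ph 𝟎 𝟎 r) = isFin r
isFin (ph 𝟎 (ph _ _ _) _) = false
isFin (ph (ph _ _ _) _ _) = false

-- modified Veblen function φ̄_α β:
-- β = β₀ + n with φ_α β₀ = β₀ holds iff β = φ_c d + n with c > α
-- (fixed points of φ_α are exactly the φ_c d with c > α; 0 is not one).
φ̄ : OT → OT → OT
φ̄ α 𝟎 = φ α 𝟎
φ̄ α (ph c d r) =
  if (c >ᵒ α) ∧ isFin r then φ α (ph c d r +ᵒ 𝟏) else φ α (ph c d r)

data Base : Set where
  fin : ℕ → Base
  ω   : Base

Val : Base → Set
Val (fin _) = ℕ
Val ω       = OT

_≤ᴮ_ : ℕ → Base → Set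
k ≤ᴮ fin l = k ≤ l
k ≤ᴮ ω     = ⊤

zeroV : (λ′ : Base) → Val λ′
zeroV (fin _) = 0
zeroV ω       = 𝟎

_+V_ : {λ′ : Base} → Val λ′ → Val λ′ → Val λ′
_+V_ {fin _} x y = x + y
_+V_ {ω}     x y = x +ᵒ y

_·V_ : {λ′ : Base} → Val λ′ → ℕ → Val λ′
_·V_ {fin _} x p = x * p
_·V_ {ω}     x p = x ·ᵒ p

AV : (λ′ : Base) → Val λ′ → Val λ′ → Val λ′
AV (fin l) x y = Ack l x y
AV ω       x y = φ̄ x y

-- Base change ⟨k → λ⟩, as the graph of the recursive definition:
-- BC k λ m v  means  ⟨k → λ⟩ m = v.

data BC (k : ℕ) (λ′ : Base) : ℕ → Val λ′ → Set where
  bc0 : BC k λ′ 0 (zeroV λ′)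
  bcS : ∀ {m a b c va vb vc} → KNF k m a b c →
        BC k λ′ a va → BC k λ′ b vb → BC k λ′ c vc →
        BC k λ′ m (AV λ′ va vb +V vc)

-- Write A = A_a(k,b) and X = A_{⟨k→λ⟩a}(λ,⟨k→λ⟩b).  If m ≡_k A + c, then every m′ with
-- A ≤ m′ ≤ m has the same normal-form head: the sequences witnessing m witness m′ too, because
-- the m_i increase up to m_n = A.  Hence A·(p+1) + q ≡_k A + (A·p + q), and unfolding the base
-- change once per summand gives X + (X·p + ⟨k→λ⟩q) = X·(p+1) + ⟨k→λ⟩q by induction on p.
-- For λ = ω the sum is computed on normal forms; it works because φ̄ always returns a single
-- additive principal φ_α β, so X·n is n equal summands.
module Submission where

open import Defs
open import Data.Nat using (ℕ; zero; suc; _+_; _*_; _^_; _≤_; _<_; z≤n; s≤s; z<s)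
open import Data.Nat.Properties
open import Data.Product using (Σ; _,_; proj₂)
open import Data.Sum using (inj₁; inj₂)
open import Data.Bool using (true; false; _∧_)
open import Data.Empty using (⊥; ⊥-elim)
open import Relation.Binary.PropositionalEquality

stepwise-mono-≤ : (f : ℕ → ℕ) {n : ℕ} → (∀ {i} → i < n → f i ≤ f (suc i)) →
                  ∀ {i j} → i ≤ j → j ≤ n → f i ≤ f j
stepwise-mono-≤ f step {j = zero} z≤n _ = ≤-refl
stepwise-mono-≤ f step {j = suc j} i≤1+j 1+j≤n with m≤n⇒m<n∨m≡n i≤1+j
... | inj₁ (s≤s i≤j) = ≤-trans (stepwise-mono-≤ f step i≤j (<⇒≤ 1+j≤n)) (step 1+j≤n)
... | inj₂ refl      = ≤-refl

module AckermannGrowth {k : ℕ} (1<k : 1 < k) where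

  ^-inflationary : ∀ x → x < k ^ x
  ^-inflationary zero    = s≤s z≤n
  ^-inflationary (suc x) = ≤-<-trans (^-inflationary x) (^-monoʳ-< k 1<k (n<1+n x))

  module _ {a : ℕ} (Aₐ-inflationary : ∀ x → x < Ack k a x) where

    iterAck-inflationary : ∀ n x → x ≤ iterAck k a n x
    iterAck-inflationary zero    x = ≤-refl
    iterAck-inflationary (suc n) x =
      <⇒≤ (≤-<-trans (iterAck-inflationary n x) (Aₐ-inflationary (iterAck k a n x)))

    iterAck-strict : ∀ n x → 0 < n → x < iterAck k a n x
    iterAck-strict (suc n) x _ =
      ≤-<-trans (iterAck-inflationary n x) (Aₐ-inflationary (iterAck k a n x))

  mutual
    Ack-inflationary : ∀ a x → x < Ack k a x
    Ack-inflationary zero    x = ^-inflationary x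
    Ack-inflationary (suc a) x = Ack′-suc-inflationary a (suc x)

    Ack′-suc-inflationary : ∀ a x → x ≤ Ack′ k (suc a) x
    Ack′-suc-inflationary a zero    = z≤n
    Ack′-suc-inflationary a (suc x) =
      ≤-<-trans (Ack′-suc-inflationary a x) (iterAck-strict (Ack-inflationary a) k _ (<-trans z<s 1<k))

  Ack-step : ∀ a x → Ack k a x ≤ Ack k a (suc x)
  Ack-step zero    x = <⇒≤ (^-monoʳ-< k 1<k (n<1+n x))
  Ack-step (suc a) x = iterAck-inflationary (Ack-inflationary a) k (Ack k (suc a) x)

  Ack-monoʳ-≤ : ∀ a {x y} → x ≤ y → Ack k a x ≤ Ack k a y
  Ack-monoʳ-≤ a x≤y = stepwise-mono-≤ (Ack k a) (λ {i} _ → Ack-step a i) x≤y ≤-refl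

remainder≤ : ∀ {k m a b c} → KNF k m a b c → c ≤ m
remainder≤ {k} {a = a} {b} {c} kn = subst (c ≤_) (sym (KNF.sum kn)) (m≤n+m c (Ack k a b))

head≤ : ∀ {k m a b c} → KNF k m a b c → Ack k a b ≤ m
head≤ {k} {a = a} {b} {c} kn = subst (Ack k a b ≤_) (sym (KNF.sum kn)) (m≤m+n (Ack k a b) c)

module KNFProperties {k : ℕ} (1<k : 1 < k) {m a b c : ℕ} (kn : KNF k m a b c) where
  open KNF kn
  open AckermannGrowth 1<k

  ms≤bs : ∀ {i} → i < n → ms i ≤ bs (suc i)
  ms≤bs {i} i<n with steps i i<n
  ... | (Aₘ≤m , _) , (_ , m<A[b+1]) , _ =
    ≮⇒≥ λ b<mᵢ → <⇒≱ m<A[b+1] (≤-trans (Ack-monoʳ-≤ (as (suc i)) b<mᵢ) Aₘ≤m)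

  ms-step : ∀ {i} → i < n → ms i ≤ ms (suc i)
  ms-step {i} i<n = begin
    ms i                                ≤⟨ ms≤bs i<n ⟩
    bs (suc i)                          ≤⟨ <⇒≤ (Ack-inflationary (as (suc i)) (bs (suc i))) ⟩
    Ack k (as (suc i)) (bs (suc i))     ≡⟨ sym (proj₂ (proj₂ (steps i i<n))) ⟩
    ms (suc i)                          ∎
    where open ≤-Reasoning

  msₙ≡head : ms n ≡ Ack k a b
  msₙ≡head = trans last (sym (cong₂ (Ack k) a≡ b≡))
    where
    last : ms n ≡ Ack k (as n) (bs n)
    last with n | n-pos | steps
    ... | suc n′ | _ | steps′ = proj₂ (proj₂ (steps′ n′ ≤-refl))

  ms≤head : ∀ {i} → i ≤ n → ms i ≤ Ack k a b
  ms≤head i≤n = ≤-trans (stepwise-mono-≤ ms ms-step i≤n ≤-refl) (≤-reflexive msₙ≡head)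

  KNF-shrinkRemainder : ∀ {m′ c′} → m′ ≡ Ack k a b + c′ → m′ ≤ m → KNF k m′ a b c′
  KNF-shrinkRemainder {m′} {c′} m′≡ m′≤m = record
    { m-pos = <-≤-trans (≤-<-trans z≤n (Ack-inflationary a b)) A≤m′
    ; n = n ; as = as ; bs = bs ; ms = ms ; n-pos = n-pos ; m₀ = m₀
    ; steps = λ i i<n → let ((_ , m<upper₁) , (_ , m<upper₂) , mᵢ₊₁≡) = steps i i<n in
        (head₁≤m′ i<n , ≤-<-trans m′≤m m<upper₁) , (head₂≤m′ i<n , ≤-<-trans m′≤m m<upper₂) , mᵢ₊₁≡
    ; final = ≤-<-trans m′≤m final
    ; a≡ = a≡ ; b≡ = b≡ ; sum = m′≡ }
    where
    A≤m′ : Ack k a b ≤ m′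
    A≤m′ = subst (Ack k a b ≤_) (sym m′≡) (m≤m+n (Ack k a b) c′)

    head₂≤m′ : ∀ {i} → i < n → Ack k (as (suc i)) (bs (suc i)) ≤ m′
    head₂≤m′ {i} i<n =
      ≤-trans (≤-reflexive (sym (proj₂ (proj₂ (steps i i<n))))) (≤-trans (ms≤head i<n) A≤m′)

    head₁≤m′ : ∀ {i} → i < n → Ack k (as (suc i)) (ms i) ≤ m′
    head₁≤m′ {i} i<n = ≤-trans (Ack-monoʳ-≤ (as (suc i)) (ms≤bs i<n)) (head₂≤m′ i<n)

extKNF-multiplier≢0 : ∀ {k m a b q} → ExtKNF k m a b 0 q → ⊥
extKNF-multiplier≢0 {k} {m} {a} {b} {q} ek = <⇒≱ q< (begin
    Ack k a b          ≤⟨ head≤ knf ⟩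
    m                  ≡⟨ eqn ⟩
    Ack k a b * 0 + q  ≡⟨ cong (_+ q) (*-zeroʳ (Ack k a b)) ⟩
    q                  ∎)
  where
  open ExtKNF ek
  open ≤-Reasoning

extKNF⇒KNF : ∀ {k m a b p q} → ExtKNF k m a b (suc p) q → KNF k m a b (Ack k a b * p + q)
extKNF⇒KNF {k} {m} {a} {b} {p} {q} ek = subst (KNF k m a b) c≡ knf
  where
  open ExtKNF ek
  A : ℕ
  A = Ack k a b
  c≡ : c ≡ A * p + q
  c≡ = +-cancelˡ-≡ A c (A * p + q) (begin
    A + c            ≡⟨ sym (KNF.sum knf) ⟩
    m                ≡⟨ eqn ⟩
    A * suc p + q    ≡⟨ cong (_+ q) (*-suc A p) ⟩
    A + A * p + q    ≡⟨ +-assoc A (A * p) q ⟩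
    A + (A * p + q)  ∎)
    where open ≡-Reasoning

mutual
  cmp-refl : ∀ x → cmp x x ≡ eq
  cmp-refl 𝟎          = refl
  cmp-refl (ph a b r) rewrite cmpPP-refl a b = cmp-refl r

  cmpPP-refl : ∀ a b → cmpPP a b a b ≡ eq
  cmpPP-refl a b rewrite cmp-refl a = cmp-refl b

phCopies : OT → OT → ℕ → OT
phCopies α β zero    = 𝟎
phCopies α β (suc n) = ph α β (phCopies α β n)

phCopies-+ᵒ-ph : ∀ α β n → phCopies α β n +ᵒ ph α β 𝟎 ≡ phCopies α β (suc n)
phCopies-+ᵒ-ph α β zero    = refl
phCopies-+ᵒ-ph α β (suc n) rewrite cmpPP-refl α β = cong (ph α β) (phCopies-+ᵒ-ph α β n)

ph-·ᵒ : ∀ α β n → ph α β 𝟎 ·ᵒ n ≡ phCopies α β n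
ph-·ᵒ α β zero    = refl
ph-·ᵒ α β (suc n) rewrite ph-·ᵒ α β n = phCopies-+ᵒ-ph α β n

ph-+ᵒ-phCopies : ∀ α β n v → ph α β 𝟎 +ᵒ (phCopies α β n +ᵒ v) ≡ phCopies α β (suc n) +ᵒ v
ph-+ᵒ-phCopies α β zero    v = refl
ph-+ᵒ-phCopies α β (suc n) 𝟎 rewrite cmpPP-refl α β = refl
ph-+ᵒ-phCopies α β (suc n) (ph a′ b′ r′) with cmpPP α β a′ b′ in α,β≟a′,b′
... | lt rewrite α,β≟a′,b′ = refl
... | eq rewrite cmpPP-refl α β | α,β≟a′,b′ = refl
... | gt rewrite cmpPP-refl α β | α,β≟a′,b′ = refl

ph-+ᵒ-·ᵒ : ∀ α β n v → ph α β 𝟎 +ᵒ ((ph α β 𝟎 ·ᵒ n) +ᵒ v) ≡ (ph α β 𝟎 ·ᵒ suc n) +ᵒ v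
ph-+ᵒ-·ᵒ α β n v = begin
  ph α β 𝟎 +ᵒ ((ph α β 𝟎 ·ᵒ n) +ᵒ v)  ≡⟨ cong (λ x → ph α β 𝟎 +ᵒ (x +ᵒ v)) (ph-·ᵒ α β n) ⟩
  ph α β 𝟎 +ᵒ (phCopies α β n +ᵒ v)   ≡⟨ ph-+ᵒ-phCopies α β n v ⟩
  phCopies α β (suc n) +ᵒ v           ≡⟨ cong (_+ᵒ v) (sym (ph-·ᵒ α β (suc n))) ⟩
  (ph α β 𝟎 ·ᵒ suc n) +ᵒ v            ∎
  where open ≡-Reasoning

Principal : OT → Set
Principal x = Σ OT λ α → Σ OT λ β → x ≡ ph α β 𝟎

φ-principal : ∀ α β → Principal (φ α β)
φ-principal α 𝟎                     = _ , _ , refl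
φ-principal α (ph c d 𝟎) with c >ᵒ α
... | true  = _ , _ , refl
... | false = _ , _ , refl
φ-principal α (ph c d (ph _ _ _))   = _ , _ , refl

φ̄-principal : ∀ α β → Principal (φ̄ α β)
φ̄-principal α 𝟎 = φ-principal α 𝟎
φ̄-principal α (ph c d r) with (c >ᵒ α) ∧ isFin r
... | true  = φ-principal α (ph c d r +ᵒ 𝟏)
... | false = φ-principal α (ph c d r)

·V-identityʳ : ∀ {λ′} (x : Val λ′) → x ·V 1 ≡ x
·V-identityʳ {fin _} x = *-identityʳ x
·V-identityʳ {ω}     x = refl

AV-+V-·V : ∀ λ′ (va vb v : Val λ′) n →
           AV λ′ va vb +V ((AV λ′ va vb ·V n) +V v) ≡ (AV λ′ va vb ·V suc n) +V v
AV-+V-·V (fin l) va vb v n =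
  sym (trans (cong (_+ v) (*-suc (Ack l va vb) n)) (+-assoc (Ack l va vb) (Ack l va vb * n) v))
AV-+V-·V ω va vb v n with φ̄-principal va vb
... | α , β , φ̄≡ph rewrite φ̄≡ph = ph-+ᵒ-·ᵒ α β n v

module BaseChangeOfMultiples {k : ℕ} (1<k : 1 < k) (λ′ : Base) {a b q : ℕ} {va vb vq : Val λ′}
       (a↦ : BC k λ′ a va) (b↦ : BC k λ′ b vb) (q↦ : BC k λ′ q vq) where

  A : ℕ
  A = Ack k a b

  X : Val λ′
  X = AV λ′ va vb

  BC-multiple : ∀ p {m} → KNF k m a b (A * p + q) → BC k λ′ m ((X ·V suc p) +V vq)
  BC-multiple zero kn =
    subst (BC k λ′ _) (cong (_+V vq) (sym (·V-identityʳ X)))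
      (bcS kn a↦ b↦ (subst (λ c → BC k λ′ c vq) (sym (cong (_+ q) (*-zeroʳ A))) q↦))
  BC-multiple (suc p) kn =
    subst (BC k λ′ _) (AV-+V-·V λ′ va vb vq (suc p))
      (bcS kn a↦ b↦ (BC-multiple p (KNFProperties.KNF-shrinkRemainder 1<k kn c≡ (remainder≤ kn))))
    where
    c≡ : A * suc p + q ≡ A + (A * p + q)
    c≡ = trans (cong (_+ q) (*-suc A p)) (+-assoc A (A * p) q)

lemma5p1 : (k : ℕ) (λ′ : Base) → 2 ≤ k → k ≤ᴮ λ′ →
           (m a b p q : ℕ) → ExtKNF k m a b p q →
           (va vb vq : Val λ′) →
           BC k λ′ a va → BC k λ′ b vb → BC k λ′ q vq →
           BC k λ′ m ((AV λ′ va vb ·V p) +V vq)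
lemma5p1 k λ′ 1<k _ m a b zero    q ek va vb vq a↦ b↦ q↦ = ⊥-elim (extKNF-multiplier≢0 ek)
lemma5p1 k λ′ 1<k _ m a b (suc p) q ek va vb vq a↦ b↦ q↦ =
  BaseChangeOfMultiples.BC-multiple 1<k λ′ a↦ b↦ q↦ p (extKNF⇒KNF ek)
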